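{- Let $\mathcal{A}\subseteq\underline{V}$ be a finite set of alternatives and let $\Gamma\subseteq\mathcal{L}$ be compositional. Then $\mathrm{EXT}_\Gamma(\mathcal{A})=\mathrm{PSO}_\Gamma(\mathcal{A})$.
   Context: Let $V$ be a finite set of variables with finite nonempty domains; outcomes are elements of $\underline{V}$; $\alpha(U)$ is restriction. A lex model $\pi$ is a (possibly empty) sequence $(Y_1,\ge_{Y_1}),\ldots,(Y_k,\ge_{Y_k})$ of pairwise distinct variables each with a total order on its domain; $V_\pi=\{Y_1,\ldots,Y_k\}$; $\mathcal{G}$ is the set of lex models. $\alpha\succ_\pi\beta$ iff for some $i$, $\alpha(Y_j)=\beta(Y_j)$ for $j<i$ and $\alpha(Y_i)>_{Y_i}\beta(Y_i)$ strictly; $\alpha\equiv_\pi\beta$ iff $\alpha(V_\pi)=\beta(V_\pi)$; $\alpha\succcurlyeq_\pi\beta$ iff $\alpha\succ_\pi\beta$ or $\alpha\equiv_\pi\beta$. For $\pi'=(Z_1,\ge_{Z_1}),\ldots$, $\pi\circ\pi'$ is $\pi$ followed by $\pi'$ with pairs whose variable is in $V_\pi$ deleted. $\mathcal{L}$ is an arbitrary set of statements with satisfaction relation $\models\ \subseteq\mathcal{G}\times\mathcal{L}$; $\pi\models\Gamma$ iff $\pi\models\varphi$ for all $\varphi\in\Gamma$. $\Gamma$ is compositional if for each $\varphi\in\Gamma$ and all $\pi,\pi'$, $\pi\models\varphi$ and $\pi'\models\varphi$ imply $\pi\circ\pi'\models\varphi$. Write $\alpha\equiv_\Gamma\beta$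 if $\alpha\equiv_\pi\beta$ for every model $\pi$ of $\Gamma$. $\mathrm{O}_\pi(\mathcal{A})=\{\alpha\in\mathcal{A}:\alpha\succcurlyeq_\pi\beta\ \forall\beta\in\mathcal{A}\}$. $\mathrm{PSO}_\Gamma(\mathcal{A})$: the $\alpha\in\mathcal{A}$ for which there is a model $\pi$ of $\Gamma$ with $\alpha\in\mathrm{O}_\pi(\mathcal{A})$ and $\alpha\equiv_\Gamma\beta$ for all $\beta\in\mathrm{O}_\pi(\mathcal{A})$. For a finite sequence $\pi_1,\ldots,\pi_k$ ($k\ge1$) define $\mathcal{A}_{\pi_1}=\mathrm{O}_{\pi_1}(\mathcal{A})$ and $\mathcal{A}_{\pi_1,\ldots,\pi_i}=\mathrm{O}_{\pi_i}(\mathcal{A}_{\pi_1,\ldots,\pi_{i-1}})$. $\mathrm{EXT}_\Gamma(\mathcal{A})$ is the set of $\alpha$ for which there is a sequence $\pi_1,\ldots,\pi_k$ of models of $\Gamma$ with $\alpha\in\mathcal{A}_{\pi_1,\ldots,\pi_k}$ and $\alpha\equiv_\Gamma\beta$ for all $\beta\in\mathcal{A}_{\pi_1,\ldots,\pi_k}$. -}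

module Defs where

open import Data.Nat using (ℕ; NonZero)
open import Data.Fin using (Fin; _≟_)
open import Data.Bool using (Bool; T)
open import Data.Empty using (⊥)
open import Data.Product using (Σ; _×_; _,_; proj₁; proj₂; ∃)
open import Data.Sum using (_⊎_)
open import Data.List using (List; []; _∷_; _++_; map; filter)
open import Data.List.Relation.Unary.All using (All; []; _∷_)
import Data.List.Relation.Unary.All as All
open import Data.List.Relation.Unary.AllPairs using (AllPairs)
import Data.List.Relation.Unary.AllPairs.Properties as AllPairsP
import Data.List.Relation.Unary.All.Properties as AllP
open import Data.List.Membership.Propositional using (_∈_; _∉_)
open import Data.List.Membership.Propositional.Properties using (∈-map⁺)
import Data.List.Membership.DecPropositional as DecMem
open import Relation.Nullary using (¬_; ¬?)
open import Relation.Binary.PropositionalEquality using (_≡_; _≢_; refl)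
open import Relation.Binary.Structures using (IsTotalOrder)

record TotalOrderOn (m : ℕ) : Set where
  field
    _≤ᵇ_        : Fin m → Fin m → Bool
    isTotalOrder : IsTotalOrder _≡_ (λ a b → T (a ≤ᵇ b))

  _≤_ : Fin m → Fin m → Set
  a ≤ b = T (a ≤ᵇ b)

  _>_ : Fin m → Fin m → Set
  a > b = (b ≤ a) × (a ≢ b)

-- The variables are Fin n; variable i has domain Fin (d i).
module Setup (n : ℕ) (d : Fin n → ℕ) where

  Outcome : Set
  Outcome = (i : Fin n) → Fin (d i)

  Entry : Set
  Entry = Σ (Fin n) (λ Y → TotalOrderOn (d Y))

  var : Entry → Fin n
  var = proj₁

  record LexModel : Set where
    constructor mkLex
    field
      seq      : List Entry
      distinct : AllPairs (λ p q → var p ≢ var q) seq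
  open LexModel public

  Vars : LexModel → List (Fin n)
  Vars π = map var (seq π)

  -- α ≻_π β  (unfolding: some i with equality before i and strict > at i)
  StrictSeq : List Entry → Outcome → Outcome → Set
  StrictSeq []            α β = ⊥
  StrictSeq ((Y , o) ∷ π) α β =
    TotalOrderOn._>_ o (α Y) (β Y) ⊎ ((α Y ≡ β Y) × StrictSeq π α β)

  _≻[_]_ : Outcome → LexModel → Outcome → Set
  α ≻[ π ] β = StrictSeq (seq π) α β

  _≡[_]_ : Outcome → LexModel → Outcome → Set
  α ≡[ π ] β = All (λ p → α (var p) ≡ β (var p)) (seq π)

  _≽[_]_ : Outcome → LexModel → Outcome → Set
  α ≽[ π ] β = (α ≻[ π ] β) ⊎ (α ≡[ π ] β)

  private
    open DecMem {A = Fin n} _≟_ using (_∈?_)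

    keep : List Entry → Entry → Set
    keep xs q = var q ∉ map var xs

    keep? : (xs : List Entry) → (q : Entry) → Relation.Nullary.Dec (keep xs q)
    keep? xs q = ¬? (var q ∈? map var xs)

    disj : (xs ys : List Entry) → All (keep xs) ys →
           All (λ p → All (λ q → var p ≢ var q) ys) xs
    disj xs ys ok = All.tabulate (λ {p} p∈ →
      All.map (λ {q} q∉ eq → q∉ (Data.List.Relation.Unary.Any.map
                 (λ { refl → Relation.Binary.PropositionalEquality.sym eq })
                 (∈-map⁺ var p∈))) ok)
      where import Data.List.Relation.Unary.Any

  _∘ₗ_ : LexModel → LexModel → LexModel
  π ∘ₗ π' = mkLex (seq π ++ filter (keep? (seq π)) (seq π'))
    (AllPairsP.++⁺ (distinct π) (AllPairsP.filter⁺ (keep? (seq π)) (distinct π'))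
      (disj (seq π) _ (AllP.all-filter (keep? (seq π)) (seq π'))))

  -- sets of outcomes are predicates (every subset of the finite set of
  -- outcomes is finite)
  OutcomeSet : Set₁
  OutcomeSet = Outcome → Set

  O : LexModel → OutcomeSet → OutcomeSet
  O π A α = A α × (∀ β → A β → α ≽[ π ] β)

  -- A_{π1,...,πk} for a nonempty sequence given as head π1 and tail
  Iter : OutcomeSet → LexModel → List LexModel → OutcomeSet
  Iter A π₁ []        = O π₁ A
  Iter A π₁ (π ∷ πs)  = Iter (O π₁ A) π πs

  module Logic (L : Set) (_⊨_ : LexModel → L → Set) where

    Subset : Set₁
    Subset = L → Set

    _⊨Γ_ : LexModel → Subset → Set
    π ⊨Γ Γ = ∀ φ → Γ φ → π ⊨ φ

    Compositional : Subset → Set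
    Compositional Γ = ∀ φ → Γ φ → ∀ π π' → π ⊨ φ → π' ⊨ φ → (π ∘ₗ π') ⊨ φ

    _≡Γ[_]_ : Outcome → Subset → Outcome → Set
    α ≡Γ[ Γ ] β = ∀ π → π ⊨Γ Γ → α ≡[ π ] β

    PSO : Subset → OutcomeSet → OutcomeSet
    PSO Γ A α = A α × Σ LexModel (λ π → (π ⊨Γ Γ) × O π A α ×
                  (∀ β → O π A β → α ≡Γ[ Γ ] β))

    EXT : Subset → OutcomeSet → OutcomeSet
    EXT Γ A α = Σ LexModel (λ π₁ → Σ (List LexModel) (λ πs →
                  (π₁ ⊨Γ Γ) × All (_⊨Γ Γ) πs × Iter A π₁ πs α ×
                  (∀ β → Iter A π₁ πs β → α ≡Γ[ Γ ] β)))

{-# OPTIONS --safe #-}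
-- The selection O_{π∘π'}(A) equals O_{π'}(O_π(A)): π∘π' compares outcomes by π
-- first and breaks π-ties by π', and the entries of π' that the composition drops
-- concern variables of π, on which π-tied outcomes agree anyway.  Hence the
-- iterated selection A_{π₁,…,πₖ} is O of the single model π₁∘(π₂∘(…∘πₖ)), which
-- is a model of Γ by compositionality; conversely a single model is a sequence
-- of length one.
module Submission where

open import Defs
open import Data.Nat using (ℕ; NonZero)
open import Data.Fin using (Fin; _≟_)
open import Data.Product using (_×_; _,_; proj₁; proj₂; uncurry)
open import Data.Sum using (_⊎_; inj₁; inj₂)
open import Data.List using (List; []; _∷_; _++_; filter)
open import Data.List.Relation.Unary.All using (All; []; _∷_)
import Data.List.Relation.Unary.All as All
import Data.List.Relation.Unary.All.Properties as AllP
open import Data.List.Membership.Propositional using (_∉_)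
import Data.List.Membership.DecPropositional as DecMembership
open import Relation.Nullary using (¬_; yes; no; contradiction)
open import Relation.Nullary.Decidable using (decidable-stable)
open import Relation.Unary using (Pred; Decidable; _⊆_; _≐_)
open import Relation.Unary.Properties using (≐-trans)
open import Relation.Binary.PropositionalEquality using (_≡_; sym; trans; subst)
open import Relation.Binary.Structures using (IsTotalOrder)

module LexComposition (n : ℕ) (d : Fin n → ℕ) where
  open Setup n d
  open DecMembership {A = Fin n} _≟_ using (_∈?_)

  Agree : List Entry → Outcome → Outcome → Set
  Agree p α β = All (λ e → α (var e) ≡ β (var e)) p

  agree-sym : ∀ {p α β} → Agree p α β → Agree p β α
  agree-sym = All.map sym

  agree-trans : ∀ {p α β γ} → Agree p α β → Agree p β γ → Agree p α γ
  agree-trans αβ βγ = All.zipWith (uncurry trans) (αβ , βγ)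

  agree⇒¬strict : ∀ p {α β} → Agree p α β → ¬ StrictSeq p α β
  agree⇒¬strict (_ ∷ _) (e ∷ _)  (inj₁ (_ , α≢β)) = α≢β e
  agree⇒¬strict (_ ∷ p) (_ ∷ es) (inj₂ (_ , s))   = agree⇒¬strict p es s

  strict-asym : ∀ p {α β} → StrictSeq p α β → ¬ StrictSeq p β α
  strict-asym ((_ , o) ∷ _) (inj₁ (β≤α , α≢β)) (inj₁ (α≤β , _)) =
    α≢β (IsTotalOrder.antisym (TotalOrderOn.isTotalOrder o) α≤β β≤α)
  strict-asym (_ ∷ _) (inj₁ (_ , α≢β)) (inj₂ (β≡α , _)) = α≢β (sym β≡α)
  strict-asym (_ ∷ _) (inj₂ (α≡β , _)) (inj₁ (_ , β≢α)) = β≢α (sym α≡β)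
  strict-asym (_ ∷ p) (inj₂ (_ , s))   (inj₂ (_ , t))   = strict-asym p s t

  strict-respˡ-agree : ∀ p {α β γ} → Agree p α β → StrictSeq p α γ → StrictSeq p β γ
  strict-respˡ-agree ((Y , o) ∷ _) {γ = γ} (e ∷ _) (inj₁ α>γ) =
    inj₁ (subst (λ x → TotalOrderOn._>_ o x (γ Y)) e α>γ)
  strict-respˡ-agree (_ ∷ p) (e ∷ es) (inj₂ (e′ , s)) =
    inj₂ (trans (sym e) e′ , strict-respˡ-agree p es s)

  strict-++⁺ˡ : ∀ p q {α β} → StrictSeq p α β → StrictSeq (p ++ q) α β
  strict-++⁺ˡ (_ ∷ _) q (inj₁ α>β)     = inj₁ α>β
  strict-++⁺ˡ (_ ∷ p) q (inj₂ (e , s)) = inj₂ (e , strict-++⁺ˡ p q s)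

  strict-++⁺ʳ : ∀ p q {α β} → Agree p α β → StrictSeq q α β → StrictSeq (p ++ q) α β
  strict-++⁺ʳ []      q []       s = s
  strict-++⁺ʳ (_ ∷ p) q (e ∷ es) s = inj₂ (e , strict-++⁺ʳ p q es s)

  strict-++⁻ : ∀ p q {α β} → StrictSeq (p ++ q) α β →
               StrictSeq p α β ⊎ (Agree p α β × StrictSeq q α β)
  strict-++⁻ []      q s              = inj₂ ([] , s)
  strict-++⁻ (_ ∷ p) q (inj₁ α>β)     = inj₁ (inj₁ α>β)
  strict-++⁻ (_ ∷ p) q (inj₂ (e , s)) with strict-++⁻ p q s
  ... | inj₁ s′         = inj₁ (inj₂ (e , s′))
  ... | inj₂ (es , s′)  = inj₂ (e ∷ es , s′)

  module _ {k} {K : Pred Entry k} (K? : Decidable K) {α β : Outcome}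
           (agree-on-dropped : ∀ e → ¬ K e → α (var e) ≡ β (var e)) where

    strict-filter⁺ : ∀ q → StrictSeq q α β → StrictSeq (filter K? q) α β
    strict-filter⁺ (e ∷ q) s with K? e | s
    ... | yes _ | inj₁ α>β        = inj₁ α>β
    ... | yes _ | inj₂ (e′ , s′)  = inj₂ (e′ , strict-filter⁺ q s′)
    ... | no ¬K | inj₁ (_ , α≢β)  = contradiction (agree-on-dropped e ¬K) α≢β
    ... | no _  | inj₂ (_ , s′)   = strict-filter⁺ q s′

    strict-filter⁻ : ∀ q → StrictSeq (filter K? q) α β → StrictSeq q α β
    strict-filter⁻ (e ∷ q) s with K? e | s
    ... | yes _ | inj₁ α>β        = inj₁ α>β
    ... | yes _ | inj₂ (e′ , s′)  = inj₂ (e′ , strict-filter⁻ q s′)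
    ... | no ¬K | s′              = inj₂ (agree-on-dropped e ¬K , strict-filter⁻ q s′)

    agree-filter⁻ : ∀ q → Agree (filter K? q) α β → Agree q α β
    agree-filter⁻ []      []  = []
    agree-filter⁻ (e ∷ q) es with K? e | es
    ... | yes _ | e′ ∷ es′ = e′ ∷ agree-filter⁻ q es′
    ... | no ¬K | es′      = agree-on-dropped e ¬K ∷ agree-filter⁻ q es′

  ≽-respˡ-≡ : ∀ π {α β γ} → α ≡[ π ] β → α ≽[ π ] γ → β ≽[ π ] γ
  ≽-respˡ-≡ π αβ (inj₁ α≻γ) = inj₁ (strict-respˡ-agree (seq π) αβ α≻γ)
  ≽-respˡ-≡ π αβ (inj₂ αγ)  = inj₂ (agree-trans (agree-sym αβ) αγ)

  ≽-antisym : ∀ π {α β} → α ≽[ π ] β → β ≽[ π ] α → α ≡[ π ] β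
  ≽-antisym π (inj₂ αβ)  _          = αβ
  ≽-antisym π (inj₁ _)   (inj₂ βα)  = agree-sym βα
  ≽-antisym π (inj₁ α≻β) (inj₁ β≻α) = contradiction β≻α (strict-asym (seq π) α≻β)

  -- The entries of π' dropped by π ∘ₗ π' are those whose variable occurs in π.
  ≡⇒agree-on-dropped : ∀ π {α β} → α ≡[ π ] β →
                       ∀ e → ¬ (var e ∉ Vars π) → α (var e) ≡ β (var e)
  ≡⇒agree-on-dropped π αβ e ¬∉ =
    All.lookup (AllP.map⁺ αβ) (decidable-stable (var e ∈? Vars π) ¬∉)

  ≻-∘ˡ⁺ : ∀ π π' {α β} → α ≻[ π ] β → α ≻[ π ∘ₗ π' ] β
  ≻-∘ˡ⁺ π π' = strict-++⁺ˡ (seq π) _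

  ≽-∘ʳ⁺ : ∀ π π' {α β} → α ≡[ π ] β → α ≽[ π' ] β → α ≽[ π ∘ₗ π' ] β
  ≽-∘ʳ⁺ π π' αβ (inj₁ α≻β) = inj₁ (strict-++⁺ʳ (seq π) _ αβ
    (strict-filter⁺ _ (≡⇒agree-on-dropped π αβ) (seq π') α≻β))
  ≽-∘ʳ⁺ π π' αβ (inj₂ αβ′) = inj₂ (AllP.++⁺ αβ (AllP.filter⁺ _ αβ′))

  ≽-∘ˡ⁻ : ∀ π π' {α β} → α ≽[ π ∘ₗ π' ] β → α ≽[ π ] β
  ≽-∘ˡ⁻ π π' (inj₁ α≻β) with strict-++⁻ (seq π) _ α≻β
  ... | inj₁ α≻β′     = inj₁ α≻β′
  ... | inj₂ (αβ , _) = inj₂ αβ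
  ≽-∘ˡ⁻ π π' (inj₂ αβ) = inj₂ (AllP.++⁻ˡ (seq π) αβ)

  ≽-∘ʳ⁻ : ∀ π π' {α β} → α ≡[ π ] β → α ≽[ π ∘ₗ π' ] β → α ≽[ π' ] β
  ≽-∘ʳ⁻ π π' αβ (inj₁ α≻β) with strict-++⁻ (seq π) _ α≻β
  ... | inj₁ α≻β′      = contradiction α≻β′ (agree⇒¬strict (seq π) αβ)
  ... | inj₂ (_ , α≻β′) =
    inj₁ (strict-filter⁻ _ (≡⇒agree-on-dropped π αβ) (seq π') α≻β′)
  ≽-∘ʳ⁻ π π' αβ (inj₂ αβ′) =
    inj₂ (agree-filter⁻ _ (≡⇒agree-on-dropped π αβ) (seq π') (AllP.++⁻ʳ (seq π) αβ′))

  O-agree : ∀ π A {α β} → O π A α → O π A β → α ≡[ π ] β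
  O-agree π A (Aα , α-max) (Aβ , β-max) = ≽-antisym π (α-max _ Aβ) (β-max _ Aα)

  O-resp-≡ : ∀ π A {α β} → O π A α → A β → α ≡[ π ] β → O π A β
  O-resp-≡ π A (_ , α-max) Aβ αβ = Aβ , λ γ Aγ → ≽-respˡ-≡ π αβ (α-max γ Aγ)

  O-O⊆O-∘ : ∀ π π' A → O π' (O π A) ⊆ O (π ∘ₗ π') A
  O-O⊆O-∘ π π' A {α} (Oα@(Aα , α-max) , α-max′) = Aα , α≽
    where
    α≽ : ∀ β → A β → α ≽[ π ∘ₗ π' ] β
    α≽ β Aβ with α-max β Aβ
    ... | inj₁ α≻β = inj₁ (≻-∘ˡ⁺ π π' α≻β)
    ... | inj₂ αβ  = ≽-∘ʳ⁺ π π' αβ (α-max′ β (O-resp-≡ π A Oα Aβ αβ))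

  O-∘⊆O-O : ∀ π π' A → O (π ∘ₗ π') A ⊆ O π' (O π A)
  O-∘⊆O-O π π' A {α} (Aα , α-max) =
    Oα , λ γ Oγ → ≽-∘ʳ⁻ π π' (O-agree π A Oα Oγ) (α-max γ (proj₁ Oγ))
    where
    Oα : O π A α
    Oα = Aα , λ β Aβ → ≽-∘ˡ⁻ π π' (α-max β Aβ)

  O-∘ : ∀ π π' A → O π' (O π A) ≐ O (π ∘ₗ π') A
  O-∘ π π' A = O-O⊆O-∘ π π' A , O-∘⊆O-O π π' A

  compose : LexModel → List LexModel → LexModel
  compose π₁ []       = π₁
  compose π₁ (π ∷ πs) = π₁ ∘ₗ compose π πs

  Iter≐O-compose : ∀ A π₁ πs → Iter A π₁ πs ≐ O (compose π₁ πs) A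
  Iter≐O-compose A π₁ []       = (λ x → x) , (λ x → x)
  Iter≐O-compose A π₁ (π ∷ πs) =
    ≐-trans (Iter≐O-compose (O π₁ A) π πs) (O-∘ π₁ (compose π πs) A)

  module _ (L : Set) (_⊨_ : LexModel → L → Set) where
    open Logic L _⊨_

    compose-⊨Γ : ∀ Γ → Compositional Γ → ∀ π₁ πs →
                 π₁ ⊨Γ Γ → All (_⊨Γ Γ) πs → compose π₁ πs ⊨Γ Γ
    compose-⊨Γ Γ comp π₁ []       π₁⊨ []        = π₁⊨
    compose-⊨Γ Γ comp π₁ (π ∷ πs) π₁⊨ (π⊨ ∷ πs⊨) φ φ∈Γ =
      comp φ φ∈Γ π₁ (compose π πs) (π₁⊨ φ φ∈Γ)
        (compose-⊨Γ Γ comp π πs π⊨ πs⊨ φ φ∈Γ)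

proposition18 : (n : ℕ) (d : Fin n → ℕ) → (∀ i → NonZero (d i)) →
                let open Setup n d in
                (L : Set) (_⊨_ : LexModel → L → Set) →
                let open Logic L _⊨_ in
                (A : OutcomeSet) (Γ : Subset) → Compositional Γ →
                ∀ α → (EXT Γ A α → PSO Γ A α) × (PSO Γ A α → EXT Γ A α)
proposition18 n d _ L _⊨_ A Γ comp α = EXT⇒PSO , PSO⇒EXT
  where
  open Setup n d
  open Logic L _⊨_
  open LexComposition n d

  EXT⇒PSO : EXT Γ A α → PSO Γ A α
  EXT⇒PSO (π₁ , πs , π₁⊨ , πs⊨ , α∈ , α-unique) =
    proj₁ Oα , compose π₁ πs , compose-⊨Γ L _⊨_ Γ comp π₁ πs π₁⊨ πs⊨ , Oα ,
    λ β Oβ → α-unique β (proj₂ (Iter≐O-compose A π₁ πs) Oβ)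
    where
    Oα : O (compose π₁ πs) A α
    Oα = proj₁ (Iter≐O-compose A π₁ πs) α∈

  PSO⇒EXT : PSO Γ A α → EXT Γ A α
  PSO⇒EXT (_ , π , π⊨ , Oα , α-unique) = π , [] , π⊨ , [] , Oα , α-unique
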